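{- Let $T$ be a p-string whose last symbol is $\$$ and in which $\$$ occurs nowhere else. For any positions $i,j$ with $1\le i<j\le |T|$, $\mathrm{lcp}^\infty(\langle T[\mathsf{R}^{ -1}_T(i)..]\rangle,\langle T[\mathsf{R}^{ -1}_T(j)..]\rangle)=\min\{\mathsf{LCP}^\infty_T[g] : i+1\le g\le j\}$.
   Context: $\Sigma_s$ (s-symbols) and $\Sigma_p$ (p-symbols) are disjoint alphabets; a p-string is a string over $\Sigma_s\cup\Sigma_p$; $\$$ is the smallest s-symbol. Strings are 1-indexed; $w[i..]$ is the suffix starting at $i$. $\infty$ is larger than every integer; the alphabet $\Sigma_s\cup\{1,2,\dots\}\cup\{\infty\}$ is totally ordered with every s-symbol smaller than every integer and $\infty$; strings are compared lexicographically. The p-encoding $\langle w\rangle$: $\langle w\rangle[i]=w[i]$ if $w[i]\in\Sigma_s$; $\infty$ if $w[i]\in\Sigma_p$ does not occur in $w[..i-1]$; otherwise $i-j$ with $j<i$ the largest position with $w[j]=w[i]$. $\mathrm{lcp}^\infty(\langle u\rangle,\langle v\rangle)$ is the number of $\infty$'s in the longest common prefix of $\langle u\rangle,\langle v\rangle$. $\mathsf{R}_T(i)$ is the lexicographic rank of $\langle T[i..]\rangle$ in $\{\langle T[j..]\rangle:1\le j\le|T|\}$, $\mathsf{R}^{ -1}_T$ its inverse. $\mathsf{LCP}^\infty_T$ is the array of length $|T|$ with $\mathsf{LCP}^\infty_T[1]=0$ and $\mathsf{LCP}^\infty_T[i]=\mathrm{lcp}^\infty(\langle T[\mathsf{R}^{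 -1}_T(i-1)..]\rangle,\langle T[\mathsf{R}^{ -1}_T(i)..]\rangle)$ for $1<i\le|T|$. -}

module Defs where

open import Level using (0ℓ)
open import Data.Nat using (ℕ; zero; suc; _+_; _∸_; _⊓_; _<_)
open import Data.Bool using (Bool; true; false; if_then_else_)
open import Data.Sum using (_⊎_; inj₁; inj₂)
open import Data.List using (List; []; _∷_; drop; length)
open import Relation.Binary.Core using (Rel)
open import Relation.Binary.Definitions using (DecidableEquality; tri<; tri≈; tri>)
open import Relation.Binary.Structures using (IsStrictTotalOrder)
open import Relation.Binary.PropositionalEquality using (_≡_; _≢_)
open import Relation.Nullary using (yes; no)

-- They are disjoint
-- by construction: a symbol is an element of the sum type Σs ⊎ Σp.
record PAlphabet : Set₁ where
  field
    Σs         : Set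
    _<s_       : Rel Σs 0ℓ
    isSTO      : IsStrictTotalOrder _≡_ _<s_
    dollar     : Σs
    dollar-min : ∀ a → a ≢ dollar → dollar <s a
    Σp         : Set
    _≟p_       : DecidableEquality Σp

module _ (A : PAlphabet) where
  open PAlphabet A

  Sym : Set
  Sym = Σs ⊎ Σp

  PString : Set
  PString = List Sym

  data ESym : Set where
    sym : Σs → ESym
    num : ℕ → ESym
    inf : ESym

  open IsStrictTotalOrder isSTO using (compare)

  ltS : Σs → Σs → Bool
  ltS a b with compare a b
  ... | tri< _ _ _ = true
  ... | tri≈ _ _ _ = false
  ... | tri> _ _ _ = false

  eqS : Σs → Σs → Bool
  eqS a b with compare a b
  ... | tri< _ _ _ = false
  ... | tri≈ _ _ _ = true
  ... | tri> _ _ _ = false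

  ltN : ℕ → ℕ → Bool
  ltN zero    zero    = false
  ltN zero    (suc _) = true
  ltN (suc _) zero    = false
  ltN (suc m) (suc n) = ltN m n

  eqN : ℕ → ℕ → Bool
  eqN zero    zero    = true
  eqN (suc m) (suc n) = eqN m n
  eqN _       _       = false

  ltE : ESym → ESym → Bool
  ltE (sym a) (sym b) = ltS a b
  ltE (sym _) (num _) = true
  ltE (sym _) inf     = true
  ltE (num m) (num n) = ltN m n
  ltE (num _) inf     = true
  ltE _       _       = false

  eqE : ESym → ESym → Bool
  eqE (sym a) (sym b) = eqS a b
  eqE (num m) (num n) = eqN m n
  eqE inf     inf     = true
  eqE _       _       = false

  ltL : List ESym → List ESym → Bool
  ltL []       []       = false
  ltL []       (_ ∷ _)  = true
  ltL (_ ∷ _)  []       = false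
  ltL (x ∷ xs) (y ∷ ys) =
    if ltE x y then true else (if eqE x y then ltL xs ys else false)

  -- distance back to the most recent occurrence of p in the reversed
  -- prefix `prev` (most recent symbol first); ∞ if none
  lookback : Σp → List Sym → ℕ → ESym
  lookback p []            k = inf
  lookback p (inj₁ _ ∷ xs) k = lookback p xs (suc k)
  lookback p (inj₂ q ∷ xs) k with p ≟p q
  ... | yes _ = num (suc k)
  ... | no  _ = lookback p xs (suc k)

  encGo : List Sym → PString → List ESym
  encGo prev []            = []
  encGo prev (inj₁ a ∷ xs) = sym a ∷ encGo (inj₁ a ∷ prev) xs
  encGo prev (inj₂ p ∷ xs) = lookback p prev 0 ∷ encGo (inj₂ p ∷ prev) xs

  enc : PString → List ESym
  enc w = encGo [] w

  suf : PString → ℕ → PString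
  suf w i = drop (i ∸ 1) w

  lcpInf : List ESym → List ESym → ℕ
  lcpInf (x ∷ xs) (y ∷ ys) =
    if eqE x y then (if eqE x inf then suc (lcpInf xs ys) else lcpInf xs ys) else 0
  lcpInf _ _ = 0

  countLess : PString → List ESym → ℕ → ℕ
  countLess T u zero    = 0
  countLess T u (suc n) =
    (if ltL (enc (suf T (suc n))) u then 1 else 0) + countLess T u n

  R : PString → ℕ → ℕ
  R T i = suc (countLess T (enc (suf T i)) (length T))

  -- R_T^{-1}(g): the position j ∈ {1..|T|} with R_T(j) = g
  -- (found by search; 0 if none — never happens for 1 ≤ g ≤ |T| when R_T is a bijection)
  searchR : PString → ℕ → ℕ → ℕ
  searchR T g zero    = 0
  searchR T g (suc n) = if eqN (R T (suc n)) g then suc n else searchR T g n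

  Rinv : PString → ℕ → ℕ
  Rinv T g = searchR T g (length T)

  LCP : PString → ℕ → ℕ
  LCP T zero            = 0
  LCP T (suc zero)      = 0
  LCP T (suc (suc k))   =
    lcpInf (enc (suf T (Rinv T (suc k)))) (enc (suf T (Rinv T (suc (suc k)))))

minFrom : (ℕ → ℕ) → ℕ → ℕ → ℕ
minFrom f a zero    = f a
minFrom f a (suc k) = f a ⊓ minFrom f (suc a) k

-- Rank order is lexicographic order of the encoded suffixes, and for a sorted triple
-- xs < ys < zs the first disagreement of xs and zs is where xs and ys or ys and zs first
-- disagree, so lcp∞(xs, zs) = lcp∞(xs, ys) ⊓ lcp∞(ys, zs). Walking from rank i to rank j
-- through consecutive ranks therefore yields the minimum of the adjacent values LCP∞[g].
-- That Rinv inverts R rests on R being injective on [1, |T|] (distinct suffixes have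
-- encodings of distinct lengths), hence a permutation by the pigeonhole principle.
module Submission where

open import Defs
open import Data.Bool using (Bool; true; false; if_then_else_)
open import Data.Empty using (⊥-elim)
open import Data.Fin using (Fin; toℕ; fromℕ<; punchOut) renaming (_≟_ to _≟ᶠ_)
open import Data.Fin.Properties using (toℕ<n; toℕ-injective; toℕ-fromℕ<; any?; injective⇒≤; punchOut-injective)
open import Data.List using (List; []; _∷_; length; drop; _++_; [_])
open import Data.List.Membership.Propositional using (_∈_)
open import Data.List.Properties using (length-drop)
open import Data.Nat using (ℕ; zero; suc; _+_; _∸_; _⊓_; _≤_; _<_; z≤n; s≤s; z<s; _≟_)
open import Data.Nat.Properties
open import Data.Product using (_×_; _,_; ∃; proj₁; proj₂)
open import Data.Sum using (_⊎_; inj₁; inj₂)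
open import Function.Definitions using (Injective)
open import Relation.Binary.Definitions using (tri<; tri≈; tri>)
open import Relation.Binary.PropositionalEquality
  using (_≡_; _≢_; refl; trans; cong; cong₂; subst; subst₂; module ≡-Reasoning) renaming (sym to ≡-sym)
open import Relation.Binary.Structures using (IsStrictTotalOrder)
open import Relation.Nullary using (¬_; yes; no; contradiction)

Trichotomous : {X : Set} → (X → X → Bool) → Set
Trichotomous {X} lt = ∀ (x y : X) → x ≡ y ⊎ (lt x y ≡ true ⊎ lt y x ≡ true)

module EncodedOrder (A : PAlphabet) where
  open PAlphabet A
  open IsStrictTotalOrder isSTO using (compare) renaming (trans to <s-trans)

  ltS⇒<s : ∀ a b → ltS A a b ≡ true → a <s b
  ltS⇒<s a b with compare a b
  ... | tri< a<b _ _ = λ _ → a<b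
  ... | tri≈ _ _ _   = λ ()
  ... | tri> _ _ _   = λ ()

  <s⇒ltS : ∀ a b → a <s b → ltS A a b ≡ true
  <s⇒ltS a b a<b with compare a b
  ... | tri< _ _ _   = refl
  ... | tri≈ a≮b _ _ = ⊥-elim (a≮b a<b)
  ... | tri> a≮b _ _ = ⊥-elim (a≮b a<b)

  ltS-irrefl : ∀ a → ltS A a a ≡ false
  ltS-irrefl a with compare a a
  ... | tri< _ a≢a _ = ⊥-elim (a≢a refl)
  ... | tri≈ _ _ _   = refl
  ... | tri> _ a≢a _ = ⊥-elim (a≢a refl)

  ltS-trichotomous : Trichotomous (ltS A)
  ltS-trichotomous a b with compare a b
  ... | tri< _ _ _   = inj₂ (inj₁ refl)
  ... | tri≈ _ a≡b _ = inj₁ a≡b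
  ... | tri> _ _ b<a = inj₂ (inj₂ (<s⇒ltS b a b<a))

  eqS-refl : ∀ a → eqS A a a ≡ true
  eqS-refl a with compare a a
  ... | tri< _ a≢a _ = ⊥-elim (a≢a refl)
  ... | tri≈ _ _ _   = refl
  ... | tri> _ a≢a _ = ⊥-elim (a≢a refl)

  eqS⇒≡ : ∀ a b → eqS A a b ≡ true → a ≡ b
  eqS⇒≡ a b with compare a b
  ... | tri< _ _ _   = λ ()
  ... | tri≈ _ a≡b _ = λ _ → a≡b
  ... | tri> _ _ _   = λ ()

  ltN-irrefl : ∀ m → ltN A m m ≡ false
  ltN-irrefl zero    = refl
  ltN-irrefl (suc m) = ltN-irrefl m

  ltN-trans : ∀ l m n → ltN A l m ≡ true → ltN A m n ≡ true → ltN A l n ≡ true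
  ltN-trans zero    (suc m) (suc n) _   _   = refl
  ltN-trans (suc l) (suc m) (suc n) l<m m<n = ltN-trans l m n l<m m<n
  ltN-trans zero    zero    _       ()  _
  ltN-trans (suc l) zero    _       ()  _
  ltN-trans _       (suc m) zero    _   ()

  ltN-trichotomous : Trichotomous (ltN A)
  ltN-trichotomous zero    zero    = inj₁ refl
  ltN-trichotomous zero    (suc n) = inj₂ (inj₁ refl)
  ltN-trichotomous (suc m) zero    = inj₂ (inj₂ refl)
  ltN-trichotomous (suc m) (suc n) with ltN-trichotomous m n
  ... | inj₁ m≡n = inj₁ (cong suc m≡n)
  ... | inj₂ lt  = inj₂ lt

  eqN-refl : ∀ m → eqN A m m ≡ true
  eqN-refl zero    = refl
  eqN-refl (suc m) = eqN-refl m

  eqN⇒≡ : ∀ m n → eqN A m n ≡ true → m ≡ n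
  eqN⇒≡ zero    zero    _   = refl
  eqN⇒≡ (suc m) (suc n) m=n = cong suc (eqN⇒≡ m n m=n)
  eqN⇒≡ zero    (suc n) ()
  eqN⇒≡ (suc m) zero    ()

  E : Set
  E = ESym A

  ltE-irrefl : ∀ (x : E) → ltE A x x ≡ false
  ltE-irrefl (sym a) = ltS-irrefl a
  ltE-irrefl (num m) = ltN-irrefl m
  ltE-irrefl inf     = refl

  ltE-trans : ∀ (x y z : E) → ltE A x y ≡ true → ltE A y z ≡ true → ltE A x z ≡ true
  ltE-trans (sym a) (sym b) (sym c) a<b b<c =
    <s⇒ltS a c (<s-trans (ltS⇒<s a b a<b) (ltS⇒<s b c b<c))
  ltE-trans (sym _) (sym _) (num _) _   _   = refl
  ltE-trans (sym _) (sym _) inf     _   _   = refl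
  ltE-trans (sym _) (num _) (num _) _   _   = refl
  ltE-trans (sym _) (num _) inf     _   _   = refl
  ltE-trans (num l) (num m) (num n) l<m m<n = ltN-trans l m n l<m m<n
  ltE-trans (num _) (num _) inf     _   _   = refl
  ltE-trans (sym _) (num _) (sym _) _   ()
  ltE-trans (num _) (num _) (sym _) _   ()
  ltE-trans (sym _) inf     _       _   ()
  ltE-trans (num _) inf     _       _   ()
  ltE-trans (num _) (sym _) _       ()  _
  ltE-trans inf     _       _       ()  _

  ltE-trichotomous : Trichotomous (ltE A)
  ltE-trichotomous (sym a) (sym b) with ltS-trichotomous a b
  ... | inj₁ a≡b = inj₁ (cong sym a≡b)
  ... | inj₂ lt  = inj₂ lt
  ltE-trichotomous (num m) (num n) with ltN-trichotomous m n
  ... | inj₁ m≡n = inj₁ (cong num m≡n)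
  ... | inj₂ lt  = inj₂ lt
  ltE-trichotomous (sym _) (num _) = inj₂ (inj₁ refl)
  ltE-trichotomous (sym _) inf     = inj₂ (inj₁ refl)
  ltE-trichotomous (num _) inf     = inj₂ (inj₁ refl)
  ltE-trichotomous (num _) (sym _) = inj₂ (inj₂ refl)
  ltE-trichotomous inf     (sym _) = inj₂ (inj₂ refl)
  ltE-trichotomous inf     (num _) = inj₂ (inj₂ refl)
  ltE-trichotomous inf     inf     = inj₁ refl

  eqE-refl : ∀ (x : E) → eqE A x x ≡ true
  eqE-refl (sym a) = eqS-refl a
  eqE-refl (num m) = eqN-refl m
  eqE-refl inf     = refl

  eqE⇒≡ : ∀ (x y : E) → eqE A x y ≡ true → x ≡ y
  eqE⇒≡ (sym a) (sym b) a=b = cong sym (eqS⇒≡ a b a=b)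
  eqE⇒≡ (num m) (num n) m=n = cong num (eqN⇒≡ m n m=n)
  eqE⇒≡ inf     inf     _   = refl
  eqE⇒≡ (sym _) (num _) ()
  eqE⇒≡ (sym _) inf     ()
  eqE⇒≡ (num _) (sym _) ()
  eqE⇒≡ (num _) inf     ()
  eqE⇒≡ inf     (sym _) ()
  eqE⇒≡ inf     (num _) ()

  ltE⇒¬eqE : ∀ (x y : E) → ltE A x y ≡ true → eqE A x y ≡ false
  ltE⇒¬eqE x y x<y with eqE A x y in x=y
  ... | false = refl
  ... | true with eqE⇒≡ x y x=y
  ...   | refl = trans (≡-sym x<y) (ltE-irrefl x)

  ltL-∷-inv : ∀ x y (xs ys : List E) → ltL A (x ∷ xs) (y ∷ ys) ≡ true →
              ltE A x y ≡ true ⊎ (x ≡ y × ltL A xs ys ≡ true)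
  ltL-∷-inv x y xs ys lt with ltE A x y
  ... | true = inj₁ refl
  ... | false with eqE A x y in x=y
  ...   | true  = inj₂ (eqE⇒≡ x y x=y , lt)
  ...   | false with lt
  ...     | ()

  ltL-head : ∀ x y (xs ys : List E) → ltE A x y ≡ true → ltL A (x ∷ xs) (y ∷ ys) ≡ true
  ltL-head x y xs ys x<y rewrite x<y = refl

  ltL-tail : ∀ x (xs ys : List E) → ltL A (x ∷ xs) (x ∷ ys) ≡ ltL A xs ys
  ltL-tail x xs ys rewrite ltE-irrefl x | eqE-refl x = refl

  ltL-irrefl : ∀ (xs : List E) → ltL A xs xs ≡ false
  ltL-irrefl []       = refl
  ltL-irrefl (x ∷ xs) = trans (ltL-tail x xs xs) (ltL-irrefl xs)

  ltL-trans : ∀ (xs ys zs : List E) → ltL A xs ys ≡ true → ltL A ys zs ≡ true → ltL A xs zs ≡ true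
  ltL-trans []       (_ ∷ _)  (_ ∷ _)  _  _  = refl
  ltL-trans (x ∷ xs) (y ∷ ys) (z ∷ zs) p q with ltL-∷-inv x y xs ys p | ltL-∷-inv y z ys zs q
  ... | inj₁ x<y          | inj₁ y<z          = ltL-head x z xs zs (ltE-trans x y z x<y y<z)
  ... | inj₁ x<y          | inj₂ (refl , _)   = ltL-head x y xs zs x<y
  ... | inj₂ (refl , _)   | inj₁ y<z          = ltL-head x z xs zs y<z
  ... | inj₂ (refl , p′)  | inj₂ (refl , q′)  = trans (ltL-tail x xs zs) (ltL-trans xs ys zs p′ q′)
  ltL-trans []       []       _        () _
  ltL-trans []       (_ ∷ _)  []       _  ()
  ltL-trans (_ ∷ _)  []       _        () _
  ltL-trans (_ ∷ _)  (_ ∷ _)  []       _  ()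

  ltL-trichotomous : Trichotomous (ltL A)
  ltL-trichotomous []       []       = inj₁ refl
  ltL-trichotomous []       (_ ∷ _)  = inj₂ (inj₁ refl)
  ltL-trichotomous (_ ∷ _)  []       = inj₂ (inj₂ refl)
  ltL-trichotomous (x ∷ xs) (y ∷ ys) with ltE-trichotomous x y
  ... | inj₂ (inj₁ x<y) = inj₂ (inj₁ (ltL-head x y xs ys x<y))
  ... | inj₂ (inj₂ y<x) = inj₂ (inj₂ (ltL-head y x ys xs y<x))
  ... | inj₁ refl with ltL-trichotomous xs ys
  ...   | inj₁ refl          = inj₁ refl
  ...   | inj₂ (inj₁ xs<ys) = inj₂ (inj₁ (trans (ltL-tail x xs ys) xs<ys))
  ...   | inj₂ (inj₂ ys<xs) = inj₂ (inj₂ (trans (ltL-tail x ys xs) ys<xs))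

  lcpInf-head-< : ∀ x y (xs ys : List E) → ltE A x y ≡ true → lcpInf A (x ∷ xs) (y ∷ ys) ≡ 0
  lcpInf-head-< x y xs ys x<y rewrite ltE⇒¬eqE x y x<y = refl

  lcpInf-∷ : ∀ x (xs ys : List E) →
             lcpInf A (x ∷ xs) (x ∷ ys) ≡ (if eqE A x inf then suc (lcpInf A xs ys) else lcpInf A xs ys)
  lcpInf-∷ x xs ys rewrite eqE-refl x = refl

  lcpInf-sorted : ∀ (xs ys zs : List E) → ltL A xs ys ≡ true → ltL A ys zs ≡ true →
                  lcpInf A xs zs ≡ lcpInf A xs ys ⊓ lcpInf A ys zs
  lcpInf-sorted []       _        _        _  _  = refl
  lcpInf-sorted (x ∷ xs) (y ∷ ys) (z ∷ zs) p q with ltL-∷-inv x y xs ys p | ltL-∷-inv y z ys zs q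
  ... | inj₁ x<y | inj₁ y<z
    rewrite lcpInf-head-< x z xs zs (ltE-trans x y z x<y y<z) | lcpInf-head-< x y xs ys x<y = refl
  ... | inj₁ x<y | inj₂ (refl , _)
    rewrite lcpInf-head-< x y xs zs x<y | lcpInf-head-< x y xs ys x<y = refl
  ... | inj₂ (refl , _) | inj₁ y<z
    rewrite lcpInf-head-< x z xs zs y<z | lcpInf-head-< x z ys zs y<z = ≡-sym (⊓-zeroʳ _)
  ... | inj₂ (refl , p′) | inj₂ (refl , q′)
    rewrite lcpInf-∷ x xs zs | lcpInf-∷ x xs ys | lcpInf-∷ x ys zs with eqE A x inf
  ...   | true  = cong suc (lcpInf-sorted xs ys zs p′ q′)
  ...   | false = lcpInf-sorted xs ys zs p′ q′
  lcpInf-sorted (_ ∷ _)  []       _        () _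
  lcpInf-sorted (_ ∷ _)  (_ ∷ _)  []       _  ()

count : (ℕ → Bool) → ℕ → ℕ
count P zero    = 0
count P (suc m) = (if P (suc m) then 1 else 0) + count P m

_⊆ᵇ_ : (ℕ → Bool) → (ℕ → Bool) → Set
P ⊆ᵇ Q = ∀ j → P j ≡ true → Q j ≡ true

indicator-mono : ∀ {P Q} → P ⊆ᵇ Q → ∀ j → (if P j then 1 else 0) ≤ (if Q j then 1 else 0)
indicator-mono {P} {Q} P⊆Q j with P j in Pj | Q j in Qj
... | false | _     = z≤n
... | true  | true  = ≤-refl
... | true  | false with trans (≡-sym (P⊆Q j Pj)) Qj
...   | ()

count-mono : ∀ {P Q} → P ⊆ᵇ Q → ∀ m → count P m ≤ count Q m
count-mono P⊆Q zero    = z≤n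
count-mono P⊆Q (suc m) = +-mono-≤ (indicator-mono P⊆Q (suc m)) (count-mono P⊆Q m)

count-strict : ∀ {P Q} → P ⊆ᵇ Q → ∀ {k m} → 1 ≤ k → k ≤ m → P k ≡ false → Q k ≡ true →
               count P m < count Q m
count-strict P⊆Q {suc _} {zero}  _   ()
count-strict P⊆Q {k}     {suc m} 1≤k k≤1+m Pk Qk with k ≟ suc m
... | yes refl rewrite Pk | Qk = s≤s (count-mono P⊆Q m)
... | no k≢1+m =
  +-mono-≤-< (indicator-mono P⊆Q (suc m))
             (count-strict P⊆Q 1≤k (≤-pred (≤∧≢⇒< k≤1+m k≢1+m)) Pk Qk)

count-true : ∀ m → count (λ _ → true) m ≡ m
count-true zero    = refl
count-true (suc m) = cong suc (count-true m)

injective⇒surjective : ∀ {n} (f : Fin n → Fin n) → Injective _≡_ _≡_ f → ∀ y → ∃ λ x → f x ≡ y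
injective⇒surjective {suc n} f f-inj y with any? (λ x → f x ≟ᶠ y)
... | yes hit = hit
... | no miss = contradiction (injective⇒≤ punched-inj) 1+n≰n
  where
  avoids : ∀ x → y ≢ f x
  avoids x y≡fx = miss (x , ≡-sym y≡fx)
  punched-inj : Injective _≡_ _≡_ (λ x → punchOut (avoids x))
  punched-inj {x} {x′} eq = f-inj (punchOut-injective (avoids x) (avoids x′) eq)

toPosition : ∀ {m} → Fin m → ℕ
toPosition i = suc (toℕ i)

toPosition-≤ : ∀ {m} (i : Fin m) → toPosition i ≤ m
toPosition-≤ i = toℕ<n i

fromPosition : ∀ {m x} → 1 ≤ x → x ≤ m → Fin m
fromPosition {x = suc x} _ x<m = fromℕ< x<m

toPosition-fromPosition : ∀ {m x} (1≤x : 1 ≤ x) (x≤m : x ≤ m) → toPosition (fromPosition 1≤x x≤m) ≡ x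
toPosition-fromPosition {x = suc x} _ x<m = cong suc (toℕ-fromℕ< x<m)

positions-injective⇒surjective :
  ∀ m (F : ℕ → ℕ) →
  (∀ k → 1 ≤ k → k ≤ m → 1 ≤ F k × F k ≤ m) →
  (∀ k l → 1 ≤ k → k ≤ m → 1 ≤ l → l ≤ m → F k ≡ F l → k ≡ l) →
  ∀ g → 1 ≤ g → g ≤ m → ∃ λ k → 1 ≤ k × k ≤ m × F k ≡ g
positions-injective⇒surjective m F F-into F-inj g 1≤g g≤m =
  toPosition i , s≤s z≤n , toPosition-≤ i ,
  trans (≡-sym (toPosition-f i)) (trans (cong toPosition fi≡g) (toPosition-fromPosition 1≤g g≤m))
  where
  F-into′ : ∀ (i : Fin m) → 1 ≤ F (toPosition i) × F (toPosition i) ≤ m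
  F-into′ i = F-into (toPosition i) (s≤s z≤n) (toPosition-≤ i)

  f : Fin m → Fin m
  f i = fromPosition (proj₁ (F-into′ i)) (proj₂ (F-into′ i))

  toPosition-f : ∀ i → toPosition (f i) ≡ F (toPosition i)
  toPosition-f i = toPosition-fromPosition (proj₁ (F-into′ i)) (proj₂ (F-into′ i))

  f-inj : Injective _≡_ _≡_ f
  f-inj {i} {j} fi≡fj = toℕ-injective (suc-injective
    (F-inj (toPosition i) (toPosition j) (s≤s z≤n) (toPosition-≤ i) (s≤s z≤n) (toPosition-≤ j)
      (trans (≡-sym (toPosition-f i)) (trans (cong toPosition fi≡fj) (toPosition-f j)))))

  i : Fin m
  i = proj₁ (injective⇒surjective f f-inj (fromPosition 1≤g g≤m))

  fi≡g : f i ≡ fromPosition 1≤g g≤m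
  fi≡g = proj₂ (injective⇒surjective f f-inj (fromPosition 1≤g g≤m))

minFrom-adjacent :
  ∀ (D : ℕ → ℕ → ℕ) (h : ℕ → ℕ) {hi} →
  (∀ a → 1 ≤ a → h (suc a) ≡ D a (suc a)) →
  (∀ a c → 1 ≤ a → suc a < c → c ≤ hi → D a c ≡ D a (suc a) ⊓ D (suc a) c) →
  ∀ k i → 1 ≤ i → suc i + k ≤ hi → D i (suc i + k) ≡ minFrom h (suc i) k
minFrom-adjacent D h h-adj split zero i 1≤i _
  rewrite +-identityʳ i = ≡-sym (h-adj i 1≤i)
minFrom-adjacent D h {hi} h-adj split (suc k) i 1≤i i+k+2≤hi = begin
  D i (suc i + suc k)                          ≡⟨ split i (suc i + suc k) 1≤i (m<m+n (suc i) z<s) i+k+2≤hi ⟩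
  D i (suc i) ⊓ D (suc i) (suc i + suc k)      ≡⟨ cong₂ _⊓_ (≡-sym (h-adj i 1≤i)) (cong (D (suc i)) shift) ⟩
  h (suc i) ⊓ D (suc i) (suc (suc i) + k)      ≡⟨ cong (h (suc i) ⊓_) (minFrom-adjacent D h h-adj split k (suc i) z<s
                                                   (subst (_≤ hi) shift i+k+2≤hi)) ⟩
  h (suc i) ⊓ minFrom h (suc (suc i)) k        ∎
  where
  open ≡-Reasoning
  shift : suc i + suc k ≡ suc (suc i) + k
  shift = cong suc (+-suc i k)

module Ranks (A : PAlphabet) (T : PString A) where
  open EncodedOrder A

  n : ℕ
  n = length T

  s : ℕ → List (ESym A)
  s k = enc A (suf A T k)

  r : ℕ → List (ESym A)
  r g = s (Rinv A T g)

  below : List (ESym A) → ℕ → Bool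
  below u j = ltL A (s j) u

  length-encGo : ∀ prev (w : PString A) → length (encGo A prev w) ≡ length w
  length-encGo prev []           = refl
  length-encGo prev (inj₁ _ ∷ w) = cong suc (length-encGo _ w)
  length-encGo prev (inj₂ _ ∷ w) = cong suc (length-encGo _ w)

  length-s : ∀ k → length (s k) ≡ n ∸ (k ∸ 1)
  length-s k = trans (length-encGo [] (drop (k ∸ 1) T)) (length-drop (k ∸ 1) T)

  -- Suffix encodings have pairwise distinct lengths, so no sentinel is needed to separate them.
  s-injective : ∀ k l → 1 ≤ k → k ≤ n → 1 ≤ l → l ≤ n → s k ≡ s l → k ≡ l
  s-injective (suc k) (suc l) _ k<n _ l<n sk≡sl =
    cong suc (∸-cancelˡ-≡ (<⇒≤ k<n) (<⇒≤ l<n)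
      (trans (≡-sym (length-s (suc k))) (trans (cong length sk≡sl) (length-s (suc l)))))

  countLess≡count : ∀ u m → countLess A T u m ≡ count (below u) m
  countLess≡count u zero    = refl
  countLess≡count u (suc m) = cong ((if below u (suc m) then 1 else 0) +_) (countLess≡count u m)

  R≡suc-count : ∀ k → R A T k ≡ suc (count (below (s k)) n)
  R≡suc-count k = cong suc (countLess≡count (s k) n)

  R-≤ : ∀ k → 1 ≤ k → k ≤ n → R A T k ≤ n
  R-≤ k 1≤k k≤n = begin
    R A T k                      ≡⟨ R≡suc-count k ⟩
    suc (count (below (s k)) n)  ≤⟨ count-strict (λ _ _ → refl) 1≤k k≤n (ltL-irrefl (s k)) refl ⟩
    count (λ _ → true) n         ≡⟨ count-true n ⟩
    n                            ∎
    where open ≤-Reasoning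

  R-< : ∀ k l → 1 ≤ k → k ≤ n → ltL A (s k) (s l) ≡ true → R A T k < R A T l
  R-< k l 1≤k k≤n sk<sl =
    subst₂ _<_ (≡-sym (R≡suc-count k)) (≡-sym (R≡suc-count l))
      (s≤s (count-strict below-mono 1≤k k≤n (ltL-irrefl (s k)) sk<sl))
    where
    below-mono : below (s k) ⊆ᵇ below (s l)
    below-mono j sj<sk = ltL-trans (s j) (s k) (s l) sj<sk sk<sl

  R-injective : ∀ k l → 1 ≤ k → k ≤ n → 1 ≤ l → l ≤ n → R A T k ≡ R A T l → k ≡ l
  R-injective k l 1≤k k≤n 1≤l l≤n Rk≡Rl with ltL-trichotomous (s k) (s l)
  ... | inj₁ sk≡sl        = s-injective k l 1≤k k≤n 1≤l l≤n sk≡sl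
  ... | inj₂ (inj₁ sk<sl) = contradiction Rk≡Rl (<⇒≢ (R-< k l 1≤k k≤n sk<sl))
  ... | inj₂ (inj₂ sl<sk) = contradiction (≡-sym Rk≡Rl) (<⇒≢ (R-< l k 1≤l l≤n sl<sk))

  searchR-correct : ∀ g m → (∃ λ k → 1 ≤ k × k ≤ m × R A T k ≡ g) →
                    1 ≤ searchR A T g m × searchR A T g m ≤ m × R A T (searchR A T g m) ≡ g
  searchR-correct g zero    (suc _ , _ , () , _)
  searchR-correct g (suc m) (k , 1≤k , k≤1+m , Rk≡g) with eqN A (R A T (suc m)) g in found
  ... | true  = s≤s z≤n , ≤-refl , eqN⇒≡ _ _ found
  ... | false with k ≟ suc m
  ...   | yes refl rewrite Rk≡g = contradiction (trans (≡-sym (eqN-refl g)) found) λ ()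
  ...   | no k≢1+m with searchR-correct g m (k , 1≤k , ≤-pred (≤∧≢⇒< k≤1+m k≢1+m) , Rk≡g)
  ...     | 1≤j , j≤m , Rj≡g = 1≤j , m≤n⇒m≤1+n j≤m , Rj≡g

  Rinv-correct : ∀ g → 1 ≤ g → g ≤ n → 1 ≤ Rinv A T g × Rinv A T g ≤ n × R A T (Rinv A T g) ≡ g
  Rinv-correct g 1≤g g≤n = searchR-correct g n
    (positions-injective⇒surjective n (R A T) (λ k 1≤k k≤n → s≤s z≤n , R-≤ k 1≤k k≤n) R-injective
       g 1≤g g≤n)

  r-sorted : ∀ a b → 1 ≤ a → a < b → b ≤ n → ltL A (r a) (r b) ≡ true
  r-sorted a b 1≤a a<b b≤n with Rinv-correct a 1≤a (≤-trans (<⇒≤ a<b) b≤n)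
                            | Rinv-correct b (≤-trans 1≤a (<⇒≤ a<b)) b≤n
  ... | 1≤x , x≤n , Rx≡a | 1≤y , y≤n , Ry≡b with ltL-trichotomous (r a) (r b)
  ...   | inj₂ (inj₁ ra<rb) = ra<rb
  ...   | inj₁ ra≡rb = contradiction
          (trans (≡-sym Rx≡a) (trans (cong (R A T) (s-injective (Rinv A T a) (Rinv A T b) 1≤x x≤n 1≤y y≤n ra≡rb)) Ry≡b))
          (<⇒≢ a<b)
  ...   | inj₂ (inj₂ rb<ra) = contradiction (subst₂ _<_ Ry≡b Rx≡a (R-< (Rinv A T b) (Rinv A T a) 1≤y y≤n rb<ra)) (<⇒≯ a<b)

  LCP-adjacent : ∀ a → 1 ≤ a → LCP A T (suc a) ≡ lcpInf A (r a) (r (suc a))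
  LCP-adjacent (suc _) _ = refl

  lcpInf-r-split : ∀ a c → 1 ≤ a → suc a < c → c ≤ n →
                   lcpInf A (r a) (r c) ≡ lcpInf A (r a) (r (suc a)) ⊓ lcpInf A (r (suc a)) (r c)
  lcpInf-r-split a c 1≤a a+1<c c≤n = lcpInf-sorted (r a) (r (suc a)) (r c)
    (r-sorted a (suc a) 1≤a ≤-refl (≤-trans (<⇒≤ a+1<c) c≤n))
    (r-sorted (suc a) c z<s a+1<c c≤n)

lemma5 : (A : PAlphabet) (U : PString A) →
    ¬ (inj₁ (PAlphabet.dollar A) ∈ U) →
    let T = U ++ [ inj₁ (PAlphabet.dollar A) ] in
    (i j : ℕ) → 1 ≤ i → i < j → j ≤ length T →
    lcpInf A (enc A (suf A T (Rinv A T i))) (enc A (suf A T (Rinv A T j)))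
    ≡ minFrom (LCP A T) (suc i) (j ∸ suc i)
lemma5 A U _ i j 1≤i i<j j≤n =
  subst (λ c → lcpInf A (r i) (r c) ≡ minFrom (LCP A T) (suc i) (j ∸ suc i)) i+1+[j∸i+1]≡j
    (minFrom-adjacent (λ a c → lcpInf A (r a) (r c)) (LCP A T) LCP-adjacent lcpInf-r-split
      (j ∸ suc i) i 1≤i (subst (_≤ n) (≡-sym i+1+[j∸i+1]≡j) j≤n))
  where
  T : PString A
  T = U ++ [ inj₁ (PAlphabet.dollar A) ]
  open Ranks A T
  i+1+[j∸i+1]≡j : suc i + (j ∸ suc i) ≡ j
  i+1+[j∸i+1]≡j = m+[n∸m]≡n i<j
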